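{- Let $E$ be a set of straight ground clauses and let $H$ be a clause whose guard literal is the least general induced guard (induced by $E$) for some signed relation name $P$, such that $H \vdash E$. Then for every literal $Q(\dots) \in H$, every position $i$ of $Q$, and all $j,k \in S^E_{P,Q,i}$, we have $\pi^H_{P,j} = \pi^H_{P,k}$.
   Context: Clauses are finite disjunctions of first-order literals, treated as sets of literals. A signed relation name is a relation name together with the polarity of a literal in which it occurs. A clause is straight if no signed relation name occurs in it twice. $\phi \vdash \psi$ ($\theta$-subsumption) means there is a variable substitution $\theta$ with $\phi\theta \subseteq \psi$; $H \vdash E$ means $H \vdash C$ for all $C \in E$. A literal $G \in H$ is a guard of $H$ if every variable of $H$ occurs in $G$. For a clause $C$ in which signed relation name $P$ occurs exactly once, $\pi^C_{P,i}$ is the term at position $i$ of that literal; $\pi^H_{P,j}$ is the term at position $j$ of the guard literal of $H$. Relative shields: for a straight clause $C$ containing $P$ and $Q$, $S^C_{P,Q,i} = \{ j \mid \pi^C_{P,j} = \pi^C_{Q,i}\}$, and for a set $E$ of straight clauses all containing $P$ and $Q$, $S^E_{P,Q,i} = \bigcap_{C\in E} S^C_{P,Q,i}$. Least general induced guard (lgig): for a set $E$ of straight ground clauses all containing signed relation name $P$, the lgig for $P$ induced by $E$ is the literal $P(\bar x)$ (of that polarity) with the least number of distinct variables such that $P(\bar x) \vdash \{P(\bar a)\}$ for every literal $P(\bar a)$ occurring in a clause of $E$; it is unique up to variable renaming. -}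

module Defs where

open import Data.Nat using (ℕ; zero; suc; _<_; _≤_; _≟_)
open import Data.Bool using (Bool)
open import Data.List using (List; []; _∷_; length; deduplicate)
open import Data.List.Membership.Propositional using (_∈_)
open import Data.Maybe using (Maybe; just; nothing)
open import Data.List using (_++_)
open import Data.List.Relation.Unary.All using (All)
open import Data.Product using (Σ; ∃; _×_; _,_)
open import Relation.Binary.PropositionalEquality using (_≡_)
open import Relation.Nullary using (¬_)

data Term : Set where
  var : ℕ → Term
  fun : ℕ → List Term → Term

record Literal : Set where
  constructor lit
  field
    pol  : Bool
    rel  : ℕ
    args : List Term
open Literal public

SRN : Set
SRN = Bool × ℕ × ℕ

sig : Literal → SRN
sig L = pol L , rel L , length (args L)

arity : SRN → ℕ
arity (_ , _ , n) = n

-- Clauses as finite sets of literals (represented by lists, with membership semantics).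
Clause : Set
Clause = List Literal

data OccT (x : ℕ) : Term → Set
data OccTs (x : ℕ) : List Term → Set
data OccT x where
  here : OccT x (var x)
  inFun : ∀ {f ts} → OccTs x ts → OccT x (fun f ts)
data OccTs x where
  hd : ∀ {t ts} → OccT x t → OccTs x (t ∷ ts)
  tl : ∀ {t ts} → OccTs x ts → OccTs x (t ∷ ts)

OccL : ℕ → Literal → Set
OccL x L = OccTs x (args L)

OccC : ℕ → Clause → Set
OccC x C = Σ Literal λ L → L ∈ C × OccL x L

GroundClause : Clause → Set
GroundClause C = ∀ x → ¬ OccC x C

Straight : Clause → Set
Straight C = ∀ {L L'} → L ∈ C → L' ∈ C → sig L ≡ sig L' → L ≡ L'

Subst : Set
Subst = ℕ → Term

applyT : Subst → Term → Term
applyTs : Subst → List Term → List Term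
applyT θ (var x) = θ x
applyT θ (fun f ts) = fun f (applyTs θ ts)
applyTs θ [] = []
applyTs θ (t ∷ ts) = applyT θ t ∷ applyTs θ ts

applyL : Subst → Literal → Literal
applyL θ (lit p r ts) = lit p r (applyTs θ ts)

_⊢_ : Clause → Clause → Set
φ ⊢ ψ = Σ Subst λ θ → ∀ {L} → L ∈ φ → applyL θ L ∈ ψ

_⊢ₛ_ : Clause → (Clause → Set) → Set
H ⊢ₛ E = ∀ C → E C → H ⊢ C

IsGuard : Literal → Clause → Set
IsGuard G H = G ∈ H × (∀ x → OccC x H → OccL x G)

-- π^C_{P,i}: the term at position i of the literal with signed relation name P
-- (well-defined when P occurs exactly once, as in straight clauses).
nth : List Term → ℕ → Maybe Term
nth [] _ = nothing
nth (t ∷ ts) zero = just t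
nth (t ∷ ts) (suc n) = nth ts n

argAt : Literal → ℕ → Maybe Term
argAt L i = nth (args L) i

-- j ∈ S^C_{P,Q,i}  :  π^C_{P,j} = π^C_{Q,i}  (j a position of P)
InS : Clause → SRN → SRN → ℕ → ℕ → Set
InS C P Q i j =
  j < arity P ×
  Σ Literal λ LP → Σ Literal λ LQ →
    LP ∈ C × LQ ∈ C × sig LP ≡ P × sig LQ ≡ Q × argAt LP j ≡ argAt LQ i

InSE : (Clause → Set) → SRN → SRN → ℕ → ℕ → Set
InSE E P Q i j = j < arity P × (∀ C → E C → InS C P Q i j)

varsTs : List Term → List ℕ
varsT : Term → List ℕ
varsT (var x) = x ∷ []
varsT (fun f ts) = varsTs ts
varsTs [] = []
varsTs (t ∷ ts) = varsT t ++ varsTs ts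

numVars : Literal → ℕ
numVars L = length (deduplicate _≟_ (varsTs (args L)))

IsVar : Term → Set
IsVar t = Σ ℕ λ x → t ≡ var x

CoversE : (Clause → Set) → SRN → Literal → Set
CoversE E P G = ∀ C L → E C → L ∈ C → sig L ≡ P → (G ∷ []) ⊢ (L ∷ [])

IsLgig : (Clause → Set) → SRN → Literal → Set
IsLgig E P G =
  sig G ≡ P × All IsVar (args G) × CoversE E P G ×
  (∀ G' → sig G' ≡ P → All IsVar (args G') → CoversE E P G' → numVars G ≤ numVars G')

-- If positions j and k of the lgig G = P(x̄) held distinct variables x ≠ y, renaming y to x
-- would give a literal P(x̄') with one variable fewer.  Every literal P(ā) of E that G
-- subsumes via θ has a_j = a_k (both equal the term at position i of the unique Q-literal
-- of its straight clause), so θ x = θ y and P(x̄') still subsumes P(ā): this contradicts the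
-- minimality of G.
module Submission where

open import Defs
open import Data.Nat using (ℕ; zero; suc; _<_; _≤_; z≤n; s≤s; _≟_)
open import Data.Nat.Properties using (≤-trans; <-≤-trans; <⇒≱)
open import Data.List using (List; []; _∷_; length; filter; deduplicate)
open import Data.List.Properties using (filter-notAll)
open import Data.List.Membership.Propositional using (_∈_; _∉_)
open import Data.List.Membership.Propositional.Properties
  using (∈-++⁻; ∈-++⁺ˡ; ∈-++⁺ʳ; ∈-filter⁺; ∈-deduplicate⁺; ∈-deduplicate⁻)
open import Data.List.Relation.Binary.Subset.Propositional using (_⊆_)
open import Data.List.Relation.Unary.Any using (here; there)
import Data.List.Relation.Unary.Any as Any
open import Data.List.Relation.Unary.All using (All; []; _∷_)
import Data.List.Relation.Unary.All as All
open import Data.List.Relation.Unary.AllPairs using ([]; _∷_)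
open import Data.List.Relation.Unary.Unique.Propositional using (Unique)
open import Data.List.Relation.Unary.Unique.DecPropositional.Properties using (deduplicate-!)
open import Data.Maybe using (just)
open import Data.Maybe.Properties using (just-injective)
open import Data.Product using (Σ; _×_; _,_; proj₁)
open import Data.Sum using (inj₁; inj₂)
open import Data.Empty using (⊥-elim)
open import Function using (_∘_)
open import Relation.Nullary using (¬?; yes; no)
open import Relation.Binary.PropositionalEquality
  using (_≡_; refl; sym; trans; cong; cong₂; _≢_; module ≡-Reasoning)

Unique-⊆⇒length≤ : {xs ys : List ℕ} → Unique xs → xs ⊆ ys → length xs ≤ length ys
Unique-⊆⇒length≤ {[]}     _            _  = z≤n
Unique-⊆⇒length≤ {a ∷ xs} {ys} (a∉xs ∷ u) xs⊆ys =
  ≤-trans (s≤s (Unique-⊆⇒length≤ u xs⊆ys-a)) (filter-notAll (¬? ∘ (_≟ a)) ys a∈ys)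
  where
  xs⊆ys-a : xs ⊆ filter (¬? ∘ (_≟ a)) ys
  xs⊆ys-a z∈xs = ∈-filter⁺ (¬? ∘ (_≟ a)) (xs⊆ys (there z∈xs)) (λ z≡a → All.lookup a∉xs z∈xs (sym z≡a))
  a∈ys = Any.map (λ { refl ¬a≡a → ¬a≡a refl }) (xs⊆ys (here refl))

Unique-⊆-∉⇒length< : {xs ys : List ℕ} {y : ℕ} →
  Unique xs → xs ⊆ ys → y ∈ ys → y ∉ xs → length xs < length ys
Unique-⊆-∉⇒length< {xs} {ys} {y} u xs⊆ys y∈ys y∉xs =
  <-≤-trans (s≤s (Unique-⊆⇒length≤ u xs⊆ys-y))
            (filter-notAll (¬? ∘ (_≟ y)) ys (Any.map (λ { refl ¬y≡y → ¬y≡y refl }) y∈ys))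
  where
  xs⊆ys-y : xs ⊆ filter (¬? ∘ (_≟ y)) ys
  xs⊆ys-y {z} z∈xs = ∈-filter⁺ (¬? ∘ (_≟ y)) (xs⊆ys z∈xs) λ { refl → y∉xs z∈xs }

length-applyTs : ∀ θ ts → length (applyTs θ ts) ≡ length ts
length-applyTs θ []       = refl
length-applyTs θ (t ∷ ts) = cong suc (length-applyTs θ ts)

sig-applyL : ∀ θ L → sig (applyL θ L) ≡ sig L
sig-applyL θ L = cong (λ n → pol L , rel L , n) (length-applyTs θ (args L))

applyT-∘ : ∀ θ σ t → applyT θ (applyT σ t) ≡ applyT (applyT θ ∘ σ) t
applyTs-∘ : ∀ θ σ ts → applyTs θ (applyTs σ ts) ≡ applyTs (applyT θ ∘ σ) ts
applyT-∘ θ σ (var x)    = refl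
applyT-∘ θ σ (fun f ts) = cong (fun f) (applyTs-∘ θ σ ts)
applyTs-∘ θ σ []       = refl
applyTs-∘ θ σ (t ∷ ts) = cong₂ _∷_ (applyT-∘ θ σ t) (applyTs-∘ θ σ ts)

applyT-cong : ∀ {θ σ} → (∀ x → θ x ≡ σ x) → ∀ t → applyT θ t ≡ applyT σ t
applyTs-cong : ∀ {θ σ} → (∀ x → θ x ≡ σ x) → ∀ ts → applyTs θ ts ≡ applyTs σ ts
applyT-cong θ≗σ (var x)    = θ≗σ x
applyT-cong θ≗σ (fun f ts) = cong (fun f) (applyTs-cong θ≗σ ts)
applyTs-cong θ≗σ []       = refl
applyTs-cong θ≗σ (t ∷ ts) = cong₂ _∷_ (applyT-cong θ≗σ t) (applyTs-cong θ≗σ ts)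

All-IsVar-rename : ∀ (f : ℕ → ℕ) {ts} → All IsVar ts → All IsVar (applyTs (var ∘ f) ts)
All-IsVar-rename f []                 = []
All-IsVar-rename f ((x , refl) ∷ vs) = (f x , refl) ∷ All-IsVar-rename f vs

varsT-rename⁻ : ∀ (f : ℕ → ℕ) t {w} → w ∈ varsT (applyT (var ∘ f) t) → Σ ℕ λ z → z ∈ varsT t × w ≡ f z
varsTs-rename⁻ : ∀ (f : ℕ → ℕ) ts {w} → w ∈ varsTs (applyTs (var ∘ f) ts) → Σ ℕ λ z → z ∈ varsTs ts × w ≡ f z
varsT-rename⁻ f (var z)    (here w≡fz) = z , here refl , w≡fz
varsT-rename⁻ f (fun g ts) w∈          = varsTs-rename⁻ f ts w∈
varsTs-rename⁻ f (t ∷ ts) w∈ with ∈-++⁻ (varsT (applyT (var ∘ f) t)) w∈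
... | inj₁ w∈t  = let z , z∈ , w≡fz = varsT-rename⁻ f t w∈t   in z , ∈-++⁺ˡ z∈ , w≡fz
... | inj₂ w∈ts = let z , z∈ , w≡fz = varsTs-rename⁻ f ts w∈ts in z , ∈-++⁺ʳ (varsT t) z∈ , w≡fz

nth-just : ∀ ts j → j < length ts → Σ Term λ t → nth ts j ≡ just t
nth-just (t ∷ ts) zero    _        = t , refl
nth-just (t ∷ ts) (suc j) (s≤s j<) = nth-just ts j j<

nth-All : ∀ {R : Term → Set} ts j {t} → All R ts → nth ts j ≡ just t → R t
nth-All (u ∷ ts) zero    (r ∷ _)  refl = r
nth-All (u ∷ ts) (suc j) (_ ∷ rs) eq   = nth-All ts j rs eq

nth-applyTs : ∀ θ ts j {t} → nth ts j ≡ just t → nth (applyTs θ ts) j ≡ just (applyT θ t)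
nth-applyTs θ (u ∷ ts) zero    refl = refl
nth-applyTs θ (u ∷ ts) (suc j) eq   = nth-applyTs θ ts j eq

nth-var⇒∈varsTs : ∀ ts j {x} → nth ts j ≡ just (var x) → x ∈ varsTs ts
nth-var⇒∈varsTs (u ∷ ts) zero    refl = ∈-++⁺ˡ {ys = varsTs ts} (here refl)
nth-var⇒∈varsTs (u ∷ ts) (suc j) eq   = ∈-++⁺ʳ (varsT u) (nth-var⇒∈varsTs ts j eq)

⊢-singleton⁻ : ∀ {G L} → (G ∷ []) ⊢ (L ∷ []) → Σ Subst λ θ → applyL θ G ≡ L
⊢-singleton⁻ (θ , sub) with sub (here refl)
... | here Gθ≡L = θ , Gθ≡L

⊢-singleton⁺ : ∀ {G L} θ → applyL θ G ≡ L → (G ∷ []) ⊢ (L ∷ [])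
⊢-singleton⁺ θ Gθ≡L = θ , λ { (here refl) → here Gθ≡L }

merge : ℕ → ℕ → ℕ → ℕ
merge x y z with z ≟ y
... | yes _ = x
... | no  _ = z

module _ {x y : ℕ} where

  merge-unifies : ∀ {θ : Subst} → θ x ≡ θ y → ∀ z → θ (merge x y z) ≡ θ z
  merge-unifies θx≡θy z with z ≟ y
  ... | yes refl = θx≡θy
  ... | no  _    = refl

  merge-≢ : x ≢ y → ∀ z → merge x y z ≢ y
  merge-≢ x≢y z with z ≟ y
  ... | yes _   = x≢y
  ... | no  z≢y = z≢y

  merge-∈ : ∀ {xs} → x ∈ xs → ∀ {z} → z ∈ xs → merge x y z ∈ xs
  merge-∈ x∈ {z} z∈ with z ≟ y
  ... | yes _ = x∈
  ... | no  _ = z∈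

  applyTs-merge : ∀ {θ} → θ x ≡ θ y → ∀ ts → applyTs θ (applyTs (var ∘ merge x y) ts) ≡ applyTs θ ts
  applyTs-merge {θ} θx≡θy ts = trans (applyTs-∘ θ (var ∘ merge x y) ts) (applyTs-cong (merge-unifies θx≡θy) ts)

  numVars-merge< : ∀ L → x ∈ varsTs (args L) → y ∈ varsTs (args L) → x ≢ y →
                   numVars (applyL (var ∘ merge x y) L) < numVars L
  numVars-merge< L x∈ y∈ x≢y =
    Unique-⊆-∉⇒length< (deduplicate-! _≟_ (varsTs ts′)) ⊆dedup (∈-deduplicate⁺ _≟_ y∈) y∉
    where
    ts = args L
    ts′ = applyTs (var ∘ merge x y) ts

    ⊆dedup : deduplicate _≟_ (varsTs ts′) ⊆ deduplicate _≟_ (varsTs ts)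
    ⊆dedup w∈ with varsTs-rename⁻ (merge x y) ts (∈-deduplicate⁻ _≟_ (varsTs ts′) w∈)
    ... | z , z∈ , refl = ∈-deduplicate⁺ _≟_ (merge-∈ x∈ z∈)

    y∉ : y ∉ deduplicate _≟_ (varsTs ts′)
    y∉ y∈′ with varsTs-rename⁻ (merge x y) ts (∈-deduplicate⁻ _≟_ (varsTs ts′) y∈′)
    ... | z , _ , y≡ = merge-≢ x≢y z (sym y≡)

  merge-covers : ∀ {E P G j k} → CoversE E P G →
    (∀ C L → E C → L ∈ C → sig L ≡ P → argAt L j ≡ argAt L k) →
    nth (args G) j ≡ just (var x) → nth (args G) k ≡ just (var y) →
    CoversE E P (applyL (var ∘ merge x y) G)
  merge-covers {G = G} {j} {k} covG agree Gj≡x Gk≡y C L EC L∈C sigL with ⊢-singleton⁻ (covG C L EC L∈C sigL)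
  ... | θ , refl = ⊢-singleton⁺ θ (cong (lit (pol G) (rel G)) (applyTs-merge θx≡θy (args G)))
    where
    open ≡-Reasoning
    θx≡θy : θ x ≡ θ y
    θx≡θy = just-injective (begin
      just (θ x)           ≡⟨ sym (nth-applyTs θ (args G) j Gj≡x) ⟩
      argAt (applyL θ G) j ≡⟨ agree C (applyL θ G) EC L∈C sigL ⟩
      argAt (applyL θ G) k ≡⟨ nth-applyTs θ (args G) k Gk≡y ⟩
      just (θ y)           ∎)

lgig-argAt-≡ : ∀ {E P G j k} → IsLgig E P G →
  (∀ C L → E C → L ∈ C → sig L ≡ P → argAt L j ≡ argAt L k) →
  j < arity P → k < arity P → argAt G j ≡ argAt G k
lgig-argAt-≡ {G = G} {j} {k} (refl , varsG , covG , minG) agree j<P k<P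
  with nth-just (args G) j j<P | nth-just (args G) k k<P
... | tj , Gj≡tj | tk , Gk≡tk with nth-All (args G) j varsG Gj≡tj | nth-All (args G) k varsG Gk≡tk
... | x , refl | y , refl with x ≟ y
... | yes refl = trans Gj≡tj (sym Gk≡tk)
... | no  x≢y  = ⊥-elim (<⇒≱ fewer (minG G′ (sig-applyL _ G) (All-IsVar-rename (merge x y) varsG)
                                             (merge-covers covG agree Gj≡tj Gk≡tk)))
  where
  G′ = applyL (var ∘ merge x y) G
  fewer : numVars G′ < numVars G
  fewer = numVars-merge< G (nth-var⇒∈varsTs (args G) j Gj≡tj) (nth-var⇒∈varsTs (args G) k Gk≡tk) x≢y

InS-argAt-≡ : ∀ {C P Q i j k L} → Straight C → InS C P Q i j → InS C P Q i k →
  L ∈ C → sig L ≡ P → argAt L j ≡ argAt L k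
InS-argAt-≡ {i = i} {j} {k} {L} straight
  (_ , LP , LQ , LP∈ , LQ∈ , refl , refl , LPj≡LQi) (_ , LP′ , LQ′ , LP′∈ , LQ′∈ , sigLP′ , sigLQ′ , LP′k≡LQ′i) L∈ sigL =
  begin
    argAt L j   ≡⟨ cong (λ M → argAt M j) (straight L∈ LP∈ sigL) ⟩
    argAt LP j  ≡⟨ LPj≡LQi ⟩
    argAt LQ i  ≡⟨ cong (λ M → argAt M i) (straight LQ∈ LQ′∈ (sym sigLQ′)) ⟩
    argAt LQ′ i ≡⟨ sym LP′k≡LQ′i ⟩
    argAt LP′ k ≡⟨ cong (λ M → argAt M k) (straight LP′∈ L∈ (trans sigLP′ (sym sigL))) ⟩
    argAt L k   ∎
  where open ≡-Reasoning

lemma7 : (E : Clause → Set) → (∀ C → E C → Straight C × GroundClause C) →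
         (P : SRN) → (H : Clause) → (G : Literal) →
         IsGuard G H → IsLgig E P G → H ⊢ₛ E →
         ∀ {Q} → Q ∈ H → (i : ℕ) → i < length (args Q) →
         (j k : ℕ) → InSE E P (sig Q) i j → InSE E P (sig Q) i k →
         argAt G j ≡ argAt G k
lemma7 E straightGround P H G _ lgig _ _ i _ j k (j<P , j∈S) (k<P , k∈S) =
  lgig-argAt-≡ lgig agree j<P k<P
  where
  agree : ∀ C L → E C → L ∈ C → sig L ≡ P → argAt L j ≡ argAt L k
  agree C L EC = InS-argAt-≡ (proj₁ (straightGround C EC)) (j∈S C EC) (k∈S C EC)
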